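{- Let $p$ and $q$ be primes with $\frac{3p-1}{2} < q < 2p-1$. Then $p$ and $q$ do not form a symmetric pair.
   Context: Two distinct primes $p$ and $q$ form a symmetric pair if $\gcd(p-1, q-1) = |p-q|$ (an equivalent form of the definition via lattice points in the rectangle with corner $(p/2,q/2)$). -}

module Defs where

open import Data.Nat.Base using (ℕ; _∸_; ∣_-_∣)
open import Data.Nat.GCD using (gcd)
open import Data.Nat.Primality using (Prime)
open import Data.Product using (_×_)
open import Relation.Binary.PropositionalEquality using (_≡_)
open import Relation.Nullary using (¬_)

SymmetricPair : ℕ → ℕ → Set
SymmetricPair p q = Prime p × Prime q × ¬ (p ≡ q) × (gcd (p ∸ 1) (q ∸ 1) ≡ ∣ p - q ∣)

{-# OPTIONS --safe #-}
module Submission where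

-- Write p = a + 1 and q = p + d. The hypothesis (3p - 1)/2 < q forces q > p, so a symmetric
-- pair would have gcd(a, a + d) = d, making d a divisor of a. But the two bounds on q say
-- d < a < 2d, and a proper divisor of a is at most a/2.

open import Defs
open import Data.Nat.Base using (ℕ; zero; suc; _+_; _*_; _∸_; _<_; _≤_; z≤n)
open import Data.Nat.Divisibility using (_∣_; divides)
open import Data.Nat.GCD using (gcd[m,n]∣m)
open import Data.Nat.Primality using (Prime)
open import Data.Nat.Properties
open import Data.Product using (_,_)
open import Relation.Binary.PropositionalEquality using (refl; sym; trans; cong; subst)
open import Relation.Nullary using (¬_; contradiction)

m∣n∧m<n⇒2*m≤n : ∀ {m n} → m ∣ n → m < n → 2 * m ≤ n
m∣n∧m<n⇒2*m≤n {m} (divides zero refl) ()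
m∣n∧m<n⇒2*m≤n {m} (divides (suc zero) refl) m<m+0 =
  contradiction m<m+0 (<-irrefl (sym (+-identityʳ m)))
m∣n∧m<n⇒2*m≤n {m} (divides (suc (suc k)) refl) _ =
  +-monoʳ-≤ m (+-monoʳ-≤ m z≤n)

2*n≤3*n∸1 : ∀ n → 2 * n ≤ 3 * n ∸ 1
2*n≤3*n∸1 zero    = z≤n
2*n≤3*n∸1 (suc n) = m≤n+m (2 * suc n) n

3*m∸1<2*n⇒m<n : ∀ m n → 3 * m ∸ 1 < 2 * n → m < n
3*m∸1<2*n⇒m<n m n h = *-cancelˡ-< 2 m n (≤-<-trans (2*n≤3*n∸1 m) h)

-- 3 * suc m ∸ 1 and 2 * suc m ∸ 1 reduce to m + 2 * suc m and m + (suc m + 0).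
3*[1+m]∸1<2*[1+m+n]⇒m<2*n : ∀ m n → 3 * suc m ∸ 1 < 2 * (suc m + n) → m < 2 * n
3*[1+m]∸1<2*[1+m+n]⇒m<2*n m n h = +-cancelʳ-< (2 * suc m) m (2 * n)
  (subst (m + 2 * suc m <_) (trans (*-distribˡ-+ 2 (suc m) n) (+-comm (2 * suc m) (2 * n))) h)

1+m+n<2*[1+m]∸1⇒n<m : ∀ m n → suc m + n < 2 * suc m ∸ 1 → n < m
1+m+n<2*[1+m]∸1⇒n<m m n h = +-cancelˡ-< (suc m) n m
  (subst (suc m + n <_) (trans (cong (m +_) (+-identityʳ (suc m))) (+-comm m (suc m))) h)

lemma2 : (p q : ℕ) → Prime p → Prime q → 3 * p ∸ 1 < 2 * q → q < 2 * p ∸ 1 → ¬ SymmetricPair p q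
lemma2 zero q _ _ _ ()
lemma2 p@(suc a) q _ _ 3p∸1<2q q<2p∸1 (_ , _ , _ , gcd≡∣p-q∣)
  with m≤n⇒∃[o]m+o≡n (<⇒≤ (3*m∸1<2*n⇒m<n p q 3p∸1<2q))
... | d , refl = contradiction (m∣n∧m<n⇒2*m≤n d∣a d<a) (<⇒≱ a<2*d)
  where
  d∣a : d ∣ a
  d∣a = subst (_∣ a) (trans gcd≡∣p-q∣ (∣m-m+n∣≡n p d)) (gcd[m,n]∣m a (a + d))
  d<a : d < a
  d<a = 1+m+n<2*[1+m]∸1⇒n<m a d q<2p∸1
  a<2*d : a < 2 * d
  a<2*d = 3*[1+m]∸1<2*[1+m+n]⇒m<2*n a d 3p∸1<2q
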